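{- Let $\psi$ be a morphism in class $\mathcal{A}_2$ and let $v\in\{0,1\}^*$. Then $\psi(\Theta(\mathrm{R}(v)))=\mathrm{E}(\psi(\Theta(v)))$.
   Context: $\mathbb{N}=\{0,1,2,\dots\}$. $\mathrm{R}(w_1\cdots w_n)=w_n\cdots w_1$; $\mathrm{E}(w_1\cdots w_n)=(1-w_n)\cdots(1-w_1)$. $\Theta(0)=01$, $\Theta(1)=10$. A morphism $\psi$ on $\{0,1\}^*$ is in class $\mathcal{A}_2$ if there exist a nonempty word $\mathfrak{w}$ and $k,h\in\mathbb{N}$ with $\psi(0)=\Theta(\mathfrak{w}(\mathrm{R}(\mathfrak{w})\mathfrak{w})^k)$ and $\psi(1)=\Theta((\mathrm{R}(\mathfrak{w})\mathfrak{w})^h\mathrm{R}(\mathfrak{w}))$. -}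

module Defs where

open import Data.Bool using (Bool; true; false; not)
open import Data.List using (List; []; _∷_; _++_; reverse; map; concatMap)
open import Data.Nat using (ℕ; zero; suc)
open import Data.Product using (Σ; ∃; ∃-syntax; _×_; _,_)
open import Relation.Binary.PropositionalEquality using (_≡_)
open import Relation.Nullary using (¬_)

-- Binary letters: false = 0, true = 1.  Words over {0,1} are List Bool.
Word : Set
Word = List Bool

R : Word → Word
R = reverse

E : Word → Word
E w = map not (reverse w)

θ : Bool → Word
θ false = false ∷ true ∷ []
θ true  = true ∷ false ∷ []

Θ : Word → Word
Θ = concatMap θ

-- A morphism on {0,1}^*, determined by its images of the letters
-- (img false = ψ(0), img true = ψ(1)), extended to words.
Morphism : Set
Morphism = Bool → Word

apply : Morphism → Word → Word
apply img = concatMap img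

pow : Word → ℕ → Word
pow u zero    = []
pow u (suc k) = u ++ pow u k

InA₂ : Morphism → Set
InA₂ ψ = ∃[ 𝔴 ] ∃[ k ] ∃[ h ]
  (¬ (𝔴 ≡ [])
   × (ψ false ≡ Θ (𝔴 ++ pow (R 𝔴 ++ 𝔴) k))
   × (ψ true  ≡ Θ (pow (R 𝔴 ++ 𝔴) h ++ R 𝔴)))

module Submission where

-- Write g a = ψ(Θ(a)) for a letter a.  Since ψ ∘ Θ is a
-- morphism, ψ(Θ(v)) is the concatenation of the blocks g(v₁) ⋯ g(vₙ), and
-- ψ(Θ(R v)) = g(vₙ) ⋯ g(v₁).  As E is an anti-morphism, the two agree up to E
-- as soon as every block g(a) is a fixed point of E (`concatMap-reverse`).
--
-- Fixed points of E: Θ(0) and Θ(1) are E-fixed, so the same lemma gives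
-- E(Θ x) = Θ(R x); hence Θ(X) is E-fixed whenever X is a palindrome.
--
-- For ψ in 𝒜₂, with P = R(𝔴)𝔴 (a palindrome), A = 𝔴 P^k and B = P^h R(𝔴),
-- we have g(0) = ψ(01) = Θ(A B) and g(1) = ψ(10) = Θ(B A), where
-- A B = 𝔴 P^(k+h) R(𝔴) and B A = P^h P^(1+k) are both palindromes.

open import Defs
open import Relation.Binary.PropositionalEquality
  using (_≡_; refl; sym; trans; cong; cong₂; subst; module ≡-Reasoning)
open import Data.Bool using (Bool; true; false; not)
open import Data.List using ([]; _∷_; _++_; reverse; map; concatMap; [_])
open import Data.List.Properties
  using (map-++; concatMap-++; reverse-++; reverse-involutive; ++-assoc; ++-identityʳ; unfold-reverse)
open import Data.Nat using (ℕ; zero; suc; _+_)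
open import Data.Nat.Properties using (+-comm)
open import Data.Product using (_,_)
open ≡-Reasoning

Palindrome : Word → Set
Palindrome X = R X ≡ X

E-++ : (a b : Word) → E (a ++ b) ≡ E b ++ E a
E-++ a b = trans (cong (map not) (reverse-++ a b)) (map-++ not (reverse b) (reverse a))

concatMap-reverse : (g : Bool → Word) → ((a : Bool) → E (g a) ≡ g a) →
                    (v : Word) → concatMap g (R v) ≡ E (concatMap g v)
concatMap-reverse g fixed [] = refl
concatMap-reverse g fixed (c ∷ v) = begin
  concatMap g (R (c ∷ v))                 ≡⟨ cong (concatMap g) (unfold-reverse c v) ⟩
  concatMap g (R v ++ [ c ])              ≡⟨ concatMap-++ g (R v) [ c ] ⟩
  concatMap g (R v) ++ g c ++ []          ≡⟨ cong₂ _++_ (concatMap-reverse g fixed v) (++-identityʳ (g c)) ⟩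
  E (concatMap g v) ++ g c                ≡⟨ cong (E (concatMap g v) ++_) (sym (fixed c)) ⟩
  E (concatMap g v) ++ E (g c)            ≡⟨ sym (E-++ (g c) (concatMap g v)) ⟩
  E (g c ++ concatMap g v)                ∎

E-θ : (c : Bool) → E (θ c) ≡ θ c
E-θ false = refl
E-θ true  = refl

E-Θ : (x : Word) → E (Θ x) ≡ Θ (R x)
E-Θ x = sym (concatMap-reverse θ E-θ x)

E-Θ-palindrome : (X : Word) → Palindrome X → E (Θ X) ≡ Θ X
E-Θ-palindrome X pal = trans (E-Θ X) (cong Θ pal)

apply-concatMap : (ψ : Morphism) (f : Bool → Word) (v : Word) →
                  apply ψ (concatMap f v) ≡ concatMap (λ a → apply ψ (f a)) v
apply-concatMap ψ f [] = refl
apply-concatMap ψ f (c ∷ v) =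
  trans (concatMap-++ ψ (f c) (concatMap f v)) (cong (apply ψ (f c) ++_) (apply-concatMap ψ f v))

pow-+ : (P : Word) (m n : ℕ) → pow P (m + n) ≡ pow P m ++ pow P n
pow-+ P zero    n = refl
pow-+ P (suc m) n = trans (cong (P ++_) (pow-+ P m n)) (sym (++-assoc P (pow P m) (pow P n)))

palindrome-pow : (P : Word) → Palindrome P → (n : ℕ) → Palindrome (pow P n)
palindrome-pow P pal zero    = refl
palindrome-pow P pal (suc n) = begin
  R (P ++ pow P n)        ≡⟨ reverse-++ P (pow P n) ⟩
  R (pow P n) ++ R P      ≡⟨ cong₂ _++_ (palindrome-pow P pal n) pal ⟩
  pow P n ++ P            ≡⟨ cong (pow P n ++_) (sym (++-identityʳ P)) ⟩
  pow P n ++ pow P 1      ≡⟨ sym (pow-+ P n 1) ⟩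
  pow P (n + 1)           ≡⟨ cong (pow P) (+-comm n 1) ⟩
  P ++ pow P n            ∎

palindrome-wrap : (u X : Word) → Palindrome X → Palindrome (u ++ X ++ R u)
palindrome-wrap u X pal = begin
  R (u ++ X ++ R u)       ≡⟨ reverse-++ u (X ++ R u) ⟩
  R (X ++ R u) ++ R u     ≡⟨ cong (_++ R u) (reverse-++ X (R u)) ⟩
  (R (R u) ++ R X) ++ R u ≡⟨ cong₂ (λ p q → (p ++ q) ++ R u) (reverse-involutive u) pal ⟩
  (u ++ X) ++ R u         ≡⟨ ++-assoc u X (R u) ⟩
  u ++ X ++ R u           ∎

palindrome-mirror-square : (w : Word) → Palindrome (R w ++ w)
palindrome-mirror-square w =
  subst (λ z → Palindrome (R w ++ z)) (reverse-involutive w) (palindrome-wrap (R w) [] refl)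

module Factors (w : Word) (k h : ℕ) where
  P A B : Word
  P = R w ++ w
  A = w ++ pow P k
  B = pow P h ++ R w

  palindrome-AB : Palindrome (A ++ B)
  palindrome-AB = subst Palindrome shape
    (palindrome-wrap w (pow P (k + h)) (palindrome-pow P (palindrome-mirror-square w) (k + h)))
    where
    shape : w ++ pow P (k + h) ++ R w ≡ A ++ B
    shape = begin
      w ++ pow P (k + h) ++ R w         ≡⟨ cong (λ z → w ++ z ++ R w) (pow-+ P k h) ⟩
      w ++ (pow P k ++ pow P h) ++ R w  ≡⟨ cong (w ++_) (++-assoc (pow P k) (pow P h) (R w)) ⟩
      w ++ pow P k ++ B                 ≡⟨ sym (++-assoc w (pow P k) B) ⟩
      A ++ B                            ∎

  palindrome-BA : Palindrome (B ++ A)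
  palindrome-BA = subst Palindrome shape (palindrome-pow P (palindrome-mirror-square w) (h + suc k))
    where
    shape : pow P (h + suc k) ≡ B ++ A
    shape = begin
      pow P (h + suc k)                ≡⟨ pow-+ P h (suc k) ⟩
      pow P h ++ (R w ++ w) ++ pow P k ≡⟨ cong (pow P h ++_) (++-assoc (R w) w (pow P k)) ⟩
      pow P h ++ R w ++ A              ≡⟨ sym (++-assoc (pow P h) (R w) A) ⟩
      B ++ A                           ∎

E-fixed-blocks : (ψ : Morphism) → InA₂ ψ → (a : Bool) → E (apply ψ (θ a)) ≡ apply ψ (θ a)
E-fixed-blocks ψ (w , k , h , _ , ψ0 , ψ1) = fixed
  where
  open Factors w k h
  -- ψ(Θ(a)) unfolds to Θ(X) Θ(Y) for (X, Y) = (A, B) or (B, A).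
  Θ-pair : (X Y : Word) → Θ X ++ Θ Y ++ [] ≡ Θ (X ++ Y)
  Θ-pair X Y = trans (cong (Θ X ++_) (++-identityʳ (Θ Y))) (sym (concatMap-++ θ X Y))
  fixed-pair : (X Y : Word) → Palindrome (X ++ Y) → E (Θ X ++ Θ Y ++ []) ≡ Θ X ++ Θ Y ++ []
  fixed-pair X Y pal = trans (cong E (Θ-pair X Y)) (trans (E-Θ-palindrome (X ++ Y) pal) (sym (Θ-pair X Y)))
  fixed : (a : Bool) → E (apply ψ (θ a)) ≡ apply ψ (θ a)
  fixed false rewrite ψ0 | ψ1 = fixed-pair A B palindrome-AB
  fixed true  rewrite ψ0 | ψ1 = fixed-pair B A palindrome-BA

lemma18 : (ψ : Morphism) → InA₂ ψ → (v : Word) →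
          apply ψ (Θ (R v)) ≡ E (apply ψ (Θ v))
lemma18 ψ ψ∈A₂ v = begin
  apply ψ (Θ (R v))  ≡⟨ apply-concatMap ψ θ (R v) ⟩
  concatMap g (R v)  ≡⟨ concatMap-reverse g (E-fixed-blocks ψ ψ∈A₂) v ⟩
  E (concatMap g v)  ≡⟨ cong E (sym (apply-concatMap ψ θ v)) ⟩
  E (apply ψ (Θ v))  ∎
  where
  g : Bool → Word
  g a = apply ψ (θ a)
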